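{- Let $M$ be a monotonic machine over a finite alphabet $\Sigma$, and let $V = \{v_1, \dots, v_N\}$ be a state of the transformed machine $S(M)$. Then a sequence $s$ covers $V$ in $S(M)$ if and only if $s$ covers at least one $v_j$ in $M$.
   Context: A machine $M$ is a finite directed acyclic graph whose edges $e$ carry labels $\mathrm{lab}(e) \in \Sigma$, with a designated initial state $i$ that has no incoming edges. If $(w,v)$ is an edge, $w$ is a parent state of $v$; ancestors are defined by iterating the parent relation. A sequence $s = s_1 \cdots s_L$ covers a state $v$ if there are indices $i_1 < \dots < i_N$ and a directed path from the initial state to $v$ of $N$ edges whose labels are, in order, $s_{i_1}, \dots, s_{i_N}$. The initial state is covered by every sequence. $M$ is monotonic if every sequence covering a state also covers each of its parent states. Construction of $S(M)$. For a set $V$ of states of $M$ and a label $a \in \Sigma$, define - $\mathrm{sub}(V;a) = \{ w : (w,v) \text{ is an edge with label } a,\ v \in V \}$; - $\mathrm{par}(V;a) = \min(\mathrm{sub}(V;a) \cup V)$, where $\min(X)$ keeps exactly those states of $X$ that have no proper ancestor in $X$; - $\mathrm{inc}(V) = \{ \mathrm{lab}(e) : e = (w,v) \text{ an edge},\ v \in V \}$. The closure is defined recursively by $\mathrm{cl}(V) = \{V\} \cup \bigcup_{a \in \mathrm{inc}(V)} \mathrm{cl}(\mathrm{par}(V;a))$, with $\mathrm{cl}(V) = \{V\}$ when $\mathrm{inc}(V)$ is empty. The states of $S(M)$ are the sets in $\bigcup_{v \in V(M)} \mathrm{cl}(\{v\})$. For each state $V$ of $S(M)$ and each $a \in \mathrm{inc}(V)$,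 there is an edge labeled $a$ from $\mathrm{par}(V;a)$ to $V$. The initial state of $S(M)$ is $\{i\}$. Coverage in $S(M)$ is defined as for any machine. -}

module Defs where

open import Data.Nat using (ℕ)
open import Data.Fin using (Fin)
open import Data.Fin.Subset using (Subset; _∈_; ⁅_⁆)
open import Data.List using (List; []; _∷_)
import Data.List.Membership.Propositional as LM
open import Data.List.Relation.Binary.Sublist.Propositional using (_⊆_)
open import Data.Product using (Σ; ∃; _×_; _,_)
open import Data.Sum using (_⊎_)
open import Relation.Binary.Construct.Closure.Transitive using (TransClosure)
open import Relation.Binary.PropositionalEquality using (_≡_; _≢_)
open import Relation.Nullary using (¬_)

data Path {Q L : Set} (E : Q → L → Q → Set) : Q → Q → List L → Set where
  nil  : ∀ {x} → Path E x x []
  step : ∀ {x u y a ls} → E x a u → Path E u y ls → Path E x y (a ∷ ls)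

Covers : {Q L : Set} (E : Q → L → Q → Set) (init : Q) → List L → Q → Set
Covers E init s v = ∃ λ ls → Path E init v ls × ls ⊆ s

Edge : ℕ → ℕ → Set
Edge n k = Fin n × Fin k × Fin n

record Machine (k : ℕ) : Set where
  field
    n     : ℕ
    edges : List (Edge n k)
    init  : Fin n

  EdgeRel : Fin n → Fin k → Fin n → Set
  EdgeRel w a v = (w , a , v) LM.∈ edges

  Parent : Fin n → Fin n → Set
  Parent w v = ∃ λ a → EdgeRel w a v

  Ancestor : Fin n → Fin n → Set
  Ancestor = TransClosure Parent

  field
    acyclic   : ∀ v → ¬ Ancestor v v
    init-root : ∀ w a → ¬ EdgeRel w a init

  CoversM : List (Fin k) → Fin n → Set
  CoversM = Covers EdgeRel init

  Monotonic : Set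
  Monotonic = ∀ s w v → Parent w v → CoversM s v → CoversM s w

  InSub : Subset n → Fin k → Fin n → Set
  InSub V a w = ∃ λ v → EdgeRel w a v × v ∈ V

  InInc : Subset n → Fin k → Set
  InInc V a = ∃ λ w → InSub V a w

  InMin : (Fin n → Set) → Fin n → Set
  InMin X x = X x × ¬ (∃ λ y → X y × Ancestor y x × y ≢ x)

  IsPar : Subset n → Fin k → Subset n → Set
  IsPar V a U = ∀ x → (x ∈ U → InMin (λ y → InSub V a y ⊎ y ∈ V) x)
                    × (InMin (λ y → InSub V a y ⊎ y ∈ V) x → x ∈ U)

  data IsSState : Subset n → Set where
    single : ∀ v → IsSState ⁅ v ⁆
    close  : ∀ {V a U} → IsSState V → InInc V a → IsPar V a U → IsSState U

  EdgeS : Subset n → Fin k → Subset n → Set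
  EdgeS U a V = IsSState V × InInc V a × IsPar V a U

  CoversS : List (Fin k) → Subset n → Set
  CoversS = Covers EdgeS ⁅ init ⁆

-- Along an edge par(V;a) → V of S(M), each state of par(V;a) lies in V or has
-- an a-edge into V, so if t covers some member of par(V;a) then t ∷ʳ a covers
-- some member of V; following an S(M)-path from {i} gives one direction.
-- Conversely, let s cover v ∈ V by a path whose last edge p → v is labelled a.
-- Then p ∈ sub(V;a), so par(V;a) contains an ancestor-or-self z of p, which the
-- prefix of the path covers by monotonicity; induction on the length of s gives
-- a covering of par(V;a) in S(M), extended by the edge par(V;a) → V. For the
-- empty path, v = i, and an S-state containing i is {i}: if one member of an
-- S-state is reachable then all are, and a reachable state other than i has i
-- as a proper ancestor, contradicting minimality in par.
module Submission where

open import Defs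
open import Level using (0ℓ)
open import Data.Nat using (ℕ; zero; suc; _<_; s≤s; z≤n)
open import Data.Nat.Induction using (<-wellFounded)
open import Data.Nat.Properties using (≤-trans)
open import Data.Fin using (Fin; zero; suc; _≟_)
open import Data.Fin.Properties using (any?)
open import Data.Fin.Induction using (spo-wellFounded)
open import Data.Fin.Subset using (Subset; _∈_; ⁅_⁆)
open import Data.Fin.Subset.Properties using (x∈⁅x⁆; x∈⁅y⁆⇒x≡y; ⊆-antisym; _∈?_)
open import Data.Vec using ([]; _∷_; here; there)
open import Data.List using (List; []; _∷_; _++_; _∷ʳ_; length)
open import Data.List.Properties using (++-assoc; ++-identityʳ)
import Data.List.Membership.DecPropositional as DecMembership
open import Data.List.Relation.Binary.Sublist.Propositional
  using (_⊆_; ⊆-refl; ⊆-trans; minimum)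
open import Data.List.Relation.Binary.Sublist.Propositional.Properties
  using (++⁺; ++⁺ʳ; length-mono-≤)
open import Data.Product using (∃; _×_; _,_; proj₁; proj₂)
open import Data.Product.Properties using (≡-dec)
open import Data.Sum using (_⊎_; inj₁; inj₂)
open import Function using (_∘_; flip; _on_)
open import Function.Bundles using (_⇔_; mk⇔)
open import Induction.WellFounded using (WellFounded; Acc; acc)
open import Relation.Binary.Core using (Rel)
open import Relation.Binary.Definitions using (Decidable)
open import Relation.Binary.Structures using (IsStrictPartialOrder)
import Relation.Binary.Construct.Flip.EqAndOrd as Flip
import Relation.Binary.Construct.On as On
open import Relation.Binary.Construct.Closure.Transitive
  using (TransClosure; [_]; _∷_) renaming (_++_ to _⁺++_)
open import Relation.Binary.PropositionalEquality
  using (_≡_; refl; sym; trans; cong; subst; resp₂; isEquivalence)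
open import Relation.Nullary using (¬_; Dec; yes; no; does; contradiction)
open import Relation.Nullary.Decidable using (map′; _×-dec_; _⊎-dec_; ¬?)
open import Relation.Unary using (Pred) renaming (Decidable to Decidable₁)

length<length-∷ʳ : {A : Set} (xs : List A) (a : A) → length xs < length (xs ∷ʳ a)
length<length-∷ʳ []       a = s≤s z≤n
length<length-∷ʳ (x ∷ xs) a = s≤s (length<length-∷ʳ xs a)

module _ {Q L : Set} {E : Q → L → Q → Set} where

  Path-∷ʳ : ∀ {x y z a ls} → Path E x y ls → E y a z → Path E x z (ls ∷ʳ a)
  Path-∷ʳ nil        e = step e nil
  Path-∷ʳ (step d p) e = step d (Path-∷ʳ p e)

  data SnocPath (x : Q) : Q → List L → Set where
    nil  : SnocPath x x []
    snoc : ∀ {p a y ls} → Path E x p ls → E p a y → SnocPath x y (ls ∷ʳ a)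

  snocView : ∀ {x y ls} → Path E x y ls → SnocPath x y ls
  snocView nil = nil
  snocView (step e p) with snocView p
  ... | nil      = snoc nil e
  ... | snoc q d = snoc (step e q) d

  Path⇒TransClosure : ∀ {x y a ls} → Path E x y (a ∷ ls) →
                      TransClosure (λ u v → ∃ λ b → E u b v) x y
  Path⇒TransClosure (step e nil)        = [ _ , e ]
  Path⇒TransClosure (step e (step d p)) = (_ , e) ∷ Path⇒TransClosure (step d p)

  module _ {init : Q} where

    Covers-mono : ∀ {s t v} → s ⊆ t → Covers E init s v → Covers E init t v
    Covers-mono s⊆t (ls , p , ls⊆s) = ls , p , ⊆-trans ls⊆s s⊆t

    Covers-∷ʳ : ∀ {s u a v} → Covers E init s u → E u a v → Covers E init (s ∷ʳ a) v
    Covers-∷ʳ (ls , p , ls⊆s) e = _ , Path-∷ʳ p e , ++⁺ ls⊆s ⊆-refl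

subset : ∀ {n} {P : Pred (Fin n) 0ℓ} → Decidable₁ P → Subset n
subset {zero}  P? = []
subset {suc n} P? = does (P? zero) ∷ subset (P? ∘ suc)

∈-subset⁻ : ∀ {n} {P : Pred (Fin n) 0ℓ} (P? : Decidable₁ P) {x} →
            x ∈ subset P? → P x
∈-subset⁻ P? {zero} x∈ with P? zero
... | yes p = p
∈-subset⁻ P? {zero} () | no _
∈-subset⁻ P? {suc x} (there x∈) = ∈-subset⁻ (P? ∘ suc) x∈

∈-subset⁺ : ∀ {n} {P : Pred (Fin n) 0ℓ} (P? : Decidable₁ P) {x} →
            P x → x ∈ subset P?
∈-subset⁺ P? {zero} p with P? zero
... | yes _ = here
... | no ¬p = contradiction p ¬p
∈-subset⁺ P? {suc x} p = there (∈-subset⁺ (P? ∘ suc) p)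

module FiniteAcyclic {n : ℕ} {R : Rel (Fin n) 0ℓ} (R? : Decidable R)
                     (R⁺-irreflexive : ∀ x → ¬ TransClosure R x x) where

  R⁺-isStrictPartialOrder : IsStrictPartialOrder _≡_ (TransClosure R)
  R⁺-isStrictPartialOrder = record
    { isEquivalence = isEquivalence
    ; irrefl        = λ { refl → R⁺-irreflexive _ }
    ; trans         = _⁺++_
    ; <-resp-≈      = resp₂ (TransClosure R)
    }

  R⁺-wellFounded : WellFounded (TransClosure R)
  R⁺-wellFounded = spo-wellFounded R⁺-isStrictPartialOrder

  R⁺-converse-wellFounded : WellFounded (flip (TransClosure R))
  R⁺-converse-wellFounded = spo-wellFounded (Flip.isStrictPartialOrder R⁺-isStrictPartialOrder)

  R⁺? : Decidable (TransClosure R)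
  R⁺? x = decideFrom (R⁺-converse-wellFounded x)
    where
    decideFrom : ∀ {x} → Acc (flip (TransClosure R)) x → ∀ y → Dec (TransClosure R x y)
    decideFrom {x} (acc rs) y = map′ fromStep toStep (any? step?)
      where
      step? : ∀ z → Dec (R x z × (z ≡ y ⊎ TransClosure R z y))
      step? z with R? x z
      ... | no ¬r = no (¬r ∘ proj₁)
      ... | yes r = map′ (r ,_) proj₂ ((z ≟ y) ⊎-dec decideFrom (rs [ r ]) y)
      fromStep : ∃ (λ z → R x z × (z ≡ y ⊎ TransClosure R z y)) → TransClosure R x y
      fromStep (_ , r , inj₁ refl) = [ r ]
      fromStep (_ , r , inj₂ r⁺)   = r ∷ r⁺
      toStep : TransClosure R x y → ∃ (λ z → R x z × (z ≡ y ⊎ TransClosure R z y))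
      toStep [ r ]    = _ , r , inj₁ refl
      toStep (r ∷ r⁺) = _ , r , inj₂ r⁺

  Minimal : Pred (Fin n) 0ℓ → Pred (Fin n) 0ℓ
  Minimal X x = X x × ¬ (∃ λ y → X y × TransClosure R y x)

  minimal-below : ∀ {X} → Decidable₁ X → ∀ {x} → X x →
                  ∃ λ y → Minimal X y × (y ≡ x ⊎ TransClosure R y x)
  minimal-below {X} X? {x} = descend (R⁺-wellFounded x)
    where
    descend : ∀ {x} → Acc (TransClosure R) x → X x →
              ∃ λ y → Minimal X y × (y ≡ x ⊎ TransClosure R y x)
    descend {x} (acc rs) Xx with any? (λ y → X? y ×-dec R⁺? y x)
    ... | no ¬below = x , (Xx , ¬below) , inj₁ refl
    ... | yes (y , Xy , y<x) with descend (rs y<x) Xy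
    ...   | z , z-min , inj₁ refl = z , z-min , inj₂ y<x
    ...   | z , z-min , inj₂ z<y  = z , z-min , inj₂ (z<y ⁺++ y<x)

module _ {k : ℕ} (M : Machine k) where
  open Machine M

  edge? : ∀ w a v → Dec (EdgeRel w a v)
  edge? w a v = (w , a , v) ∈ₗ? edges
    where open DecMembership (≡-dec _≟_ (≡-dec _≟_ _≟_)) renaming (_∈?_ to _∈ₗ?_)

  parent? : Decidable Parent
  parent? w v = any? (λ a → edge? w a v)

  open FiniteAcyclic parent? acyclic
    renaming (R⁺? to ancestor?; minimal-below to minimal-ancestor-or-self)

  Minimal⇒InMin : ∀ {X x} → Minimal X x → InMin X x
  Minimal⇒InMin (Xx , ¬below) = Xx , λ (y , Xy , y<x , _) → ¬below (y , Xy , y<x)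

  InMin? : ∀ {X} → Decidable₁ X → Decidable₁ (InMin X)
  InMin? X? x = X? x ×-dec ¬? (any? λ y → X? y ×-dec (ancestor? y x ×-dec ¬? (y ≟ x)))

  sub∪? : ∀ V a → Decidable₁ (λ y → InSub V a y ⊎ y ∈ V)
  sub∪? V a y = any? (λ v → edge? y a v ×-dec (v ∈? V)) ⊎-dec (y ∈? V)

  par : Subset n → Fin k → Subset n
  par V a = subset (InMin? (sub∪? V a))

  par-isPar : ∀ V a → IsPar V a (par V a)
  par-isPar V a x = ∈-subset⁻ (InMin? (sub∪? V a)) , ∈-subset⁺ (InMin? (sub∪? V a))

  IsPar⇒⊆sub∪ : ∀ {V a U x} → IsPar V a U → x ∈ U → InSub V a x ⊎ x ∈ V
  IsPar⇒⊆sub∪ isPar x∈U = proj₁ (proj₁ (isPar _) x∈U)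

  Reachable : Fin n → Set
  Reachable v = ∃ λ s → CoversM s v

  CoversSome : List (Fin k) → Subset n → Set
  CoversSome s V = ∃ λ j → j ∈ V × CoversM s j

  coversSome-mono : ∀ {s t V} → s ⊆ t → CoversSome s V → CoversSome t V
  coversSome-mono s⊆t (j , j∈V , c) = j , j∈V , Covers-mono s⊆t c

  coversSome-step : ∀ {U a V t} → EdgeS U a V → CoversSome t U → CoversSome (t ∷ʳ a) V
  coversSome-step (_ , _ , isPar) (u , u∈U , c) with IsPar⇒⊆sub∪ isPar u∈U
  ... | inj₁ (v , e , v∈V) = v , v∈V , Covers-∷ʳ c e
  ... | inj₂ u∈V           = u , u∈V , Covers-mono (++⁺ʳ _ ⊆-refl) c

  coversSome-along : ∀ {U W ls t} → Path EdgeS U W ls →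
                     CoversSome t U → CoversSome (t ++ ls) W
  coversSome-along {t = t} nil c = subst (λ s → CoversSome s _) (sym (++-identityʳ t)) c
  coversSome-along {t = t} (step {a = a} {ls = ls} e p) c =
    subst (λ s → CoversSome s _) (++-assoc t (a ∷ []) ls)
          (coversSome-along p (coversSome-step e c))

  coversS⇒coversSome : ∀ {s V} → CoversS s V → CoversSome s V
  coversS⇒coversSome (ls , p , ls⊆s) =
    coversSome-mono ls⊆s (coversSome-along p (init , x∈⁅x⁆ init , [] , nil , ⊆-refl))

  module _ (mono : Monotonic) where

    ancestor-covered : ∀ {s w v} → Ancestor w v → CoversM s v → CoversM s w
    ancestor-covered [ p ]   c = mono _ _ _ p c
    ancestor-covered (p ∷ a) c = mono _ _ _ p (ancestor-covered a c)

    reachable-in-SState : ∀ {V} → IsSState V → ∀ {x y} → x ∈ V → y ∈ V →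
                          Reachable x → Reachable y
    reachable-in-SState (single v) x∈V y∈V r =
      subst Reachable (trans (x∈⁅y⁆⇒x≡y v x∈V) (sym (x∈⁅y⁆⇒x≡y v y∈V))) r
    reachable-in-SState (close {V} {a} sV _ isPar) {x} x∈U y∈U (s , c) =
      reachable-from (reachable-to (IsPar⇒⊆sub∪ isPar x∈U)) (IsPar⇒⊆sub∪ isPar y∈U)
      where
      reachable-to : InSub V a x ⊎ x ∈ V → ∃ λ v → v ∈ V × Reachable v
      reachable-to (inj₁ (v , e , v∈V)) = v , v∈V , s ∷ʳ a , Covers-∷ʳ c e
      reachable-to (inj₂ x∈V)           = x , x∈V , s , c
      reachable-from : (∃ λ v → v ∈ V × Reachable v) →
                       ∀ {y} → InSub V a y ⊎ y ∈ V → Reachable y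
      reachable-from (v , v∈V , r) (inj₁ (w , e , w∈V)) =
        let (t , cw) = reachable-in-SState sV v∈V w∈V r in t , mono t _ w (a , e) cw
      reachable-from (v , v∈V , r) (inj₂ y∈V) = reachable-in-SState sV v∈V y∈V r

    init∈SState⇒≡⁅init⁆ : ∀ {V} → IsSState V → init ∈ V → V ≡ ⁅ init ⁆
    init∈SState⇒≡⁅init⁆ (single v) init∈V = cong ⁅_⁆ (sym (x∈⁅y⁆⇒x≡y v init∈V))
    init∈SState⇒≡⁅init⁆ {V} sV@(close _ _ isPar) init∈V =
      ⊆-antisym (λ x∈V → subst (_∈ ⁅ init ⁆) (sym (≡init x∈V)) (x∈⁅x⁆ init))
                (λ x∈⁅init⁆ → subst (_∈ V) (sym (x∈⁅y⁆⇒x≡y init x∈⁅init⁆)) init∈V)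
      where
      ≡init : ∀ {x} → x ∈ V → x ≡ init
      ≡init x∈V with reachable-in-SState sV init∈V x∈V ([] , [] , nil , minimum [])
      ... | _ , [] , nil , _ = refl
      ... | _ , _ ∷ _ , p , _ =
        let init<x = Path⇒TransClosure p
            init≢x = λ { refl → acyclic init init<x }
        in contradiction (init , IsPar⇒⊆sub∪ isPar init∈V , init<x , init≢x)
                         (proj₂ (proj₁ (isPar _) x∈V))

    coversSome⇒coversS : ∀ {s V} → IsSState V → CoversSome s V → CoversS s V
    coversSome⇒coversS {s} = by-length (On.wellFounded length <-wellFounded s)
      where
      by-length : ∀ {s V} → Acc (_<_ on length) s →
                  IsSState V → CoversSome s V → CoversS s V
      by-length {s} {V} (acc rs) sV (j , j∈V , ls , path , ls⊆s) with snocView path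
      ... | nil = subst (CoversS s) (sym (init∈SState⇒≡⁅init⁆ sV j∈V)) ([] , nil , minimum s)
      ... | snoc {p} {a} {ls = ls′} q e =
        Covers-mono ls⊆s (Covers-∷ʳ par-covered (sV , inc , par-isPar V a))
        where
        inc : InInc V a
        inc = p , j , e , j∈V
        par-covered : CoversS ls′ (par V a)
        par-covered with minimal-ancestor-or-self (sub∪? V a) (inj₁ (j , e , j∈V))
        ... | z , z-min , z≼p =
          by-length (rs (≤-trans (length<length-∷ʳ ls′ a) (length-mono-≤ ls⊆s)))
                    (close sV inc (par-isPar V a))
                    (z , ∈-subset⁺ (InMin? (sub∪? V a)) (Minimal⇒InMin z-min) , z-covered z≼p)
          where
          z-covered : ∀ {z} → z ≡ p ⊎ Ancestor z p → CoversM ls′ z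
          z-covered (inj₁ refl) = ls′ , q , ⊆-refl
          z-covered (inj₂ z<p)  = ancestor-covered z<p (ls′ , q , ⊆-refl)

mainTheorem4 : (k : ℕ) (M : Machine k) → Machine.Monotonic M →
    ∀ V → Machine.IsSState M V → (s : List (Fin k)) →
    Machine.CoversS M s V ⇔ (∃ λ j → j ∈ V × Machine.CoversM M s j)
mainTheorem4 k M mono V sV s = mk⇔ (coversS⇒coversSome M) (coversSome⇒coversS M mono sV)
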